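{- In the standard variable-processor cup game on $n$ cups starting with all fills $0$, against the greedy emptier, the filler has a strategy that achieves a backlog of at least $\frac{n-1}{2}$ at the end of some round among the first $n^3$ rounds.
   Context: Standard variable-processor cup game: $n$ cups with real fills, initially $0$. Each round the filler chooses an integer $1 \le p \le n$ and reals $a_1,\dots,a_n\in[0,1]$ with $\sum a_i = p$ and adds $a_i$ to cup $i$; the emptier then chooses exactly $p$ distinct cups and replaces each chosen fill $x$ by $\max(0,x-1)$. The greedy emptier chooses the $p$ cups with the largest fills after the filler's move (ties arbitrary). The backlog is the maximum fill. -}

module Defs where

open import Data.Nat as ℕ using (ℕ; zero; suc; _∸_)
open import Data.Integer using (+_)
open import Data.Rational using (ℚ; _+_; _-_; _⊔_; _≤_; 0ℚ; 1ℚ; _/_)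
open import Data.Fin using (Fin; zero; suc)
open import Data.Fin.Subset using (Subset; _∈_; _∉_; ∣_∣)
open import Data.Vec using (lookup)
open import Data.Bool using (if_then_else_)
open import Data.List using (List; []; _∷_)
open import Data.Product using (Σ; _×_; _,_; proj₁)
open import Relation.Binary.PropositionalEquality using (_≡_)

Fills : ℕ → Set
Fills n = Fin n → ℚ

initial : ∀ {n} → Fills n
initial _ = 0ℚ

ℕ→ℚ : ℕ → ℚ
ℕ→ℚ k = + k / 1

sumF : ∀ {n} → (Fin n → ℚ) → ℚ
sumF {zero}  f = 0ℚ
sumF {suc n} f = f zero + sumF (λ i → f (suc i))

-- backlog = maximum fill (fold of ⊔, base 0; fills are always ≥ 0)
backlog : ∀ {n} → Fills n → ℚ
backlog {zero}  f = 0ℚ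
backlog {suc n} f = f zero ⊔ backlog (λ i → f (suc i))

record Move (n : ℕ) : Set where
  field
    p       : ℕ
    p≥1     : 1 ℕ.≤ p
    p≤n     : p ℕ.≤ n
    amt     : Fin n → ℚ
    amt≥0   : ∀ i → 0ℚ ≤ amt i
    amt≤1   : ∀ i → amt i ≤ 1ℚ
    amt-sum : sumF amt ≡ ℕ→ℚ p
open Move public

addMove : ∀ {n} → Fills n → Move n → Fills n
addMove f m i = f i + amt m i

emptySet : ∀ {n} → Fills n → Subset n → Fills n
emptySet f S i = if lookup S i then 0ℚ ⊔ (f i - 1ℚ) else f i

IsGreedy : ∀ {n} → Fills n → ℕ → Subset n → Set
IsGreedy b p S = ∣ S ∣ ≡ p × (∀ i j → i ∈ S → j ∉ S → b j ≤ b i)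

GreedyChoice : ∀ {n} → Fills n → ℕ → Set
GreedyChoice b p = Σ (Subset _) (IsGreedy b p)

Round : ℕ → Set
Round n = Move n × Subset n

-- History of play, most recent round first.
History : ℕ → Set
History n = List (Round n)

stateOf : ∀ {n} → History n → Fills n
stateOf []            = initial
stateOf ((m , S) ∷ h) = emptySet (addMove (stateOf h) m) S

FillerStrategy : ℕ → Set
FillerStrategy n = History n → Move n

-- a greedy emptier (ties broken arbitrarily, possibly adaptively)
GreedyEmptier : ℕ → Set
GreedyEmptier n = (h : History n) (m : Move n) →
  GreedyChoice (addMove (stateOf h) m) (p m)

play : ∀ {n} → FillerStrategy n → GreedyEmptier n → ℕ → History n
play F E zero    = []
play F E (suc t) = (F h , proj₁ (E h (F h))) ∷ h
  where h = play F E t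

{-# OPTIONS --safe #-}
module Submission where

-- Work in quarter units. Call a pair (i , j) of distinct cups admissible when
-- cup i is at most a quarter above cup j. Such a shift of a quarter from j to i
-- can be forced in one round against any greedy emptier: the filler puts 3/4
-- into j, 1/4 into i, and a full unit into every other cup at least 3/4 above
-- j, with one processor for each cup receiving at least 3/4. Afterwards these
-- cups are strictly fuller than all others, so the greedy emptier must empty
-- exactly them. Keeping the last cup z = n - 1 empty as a reservoir (its
-- loss is truncated at 0), a quarter can be inserted into any cup holding at
-- most 1/4 and carried up a staircase with steps of 1/2 by a cascade of
-- shifts. Two sweeps over cups 0..k turn the staircase of height k/2 into one
-- of height (k+1)/2 in at most 2(k+1)^2 rounds, so after z phases, fewer than
-- n^3 rounds in total, cup 0 holds z/2 = (n-1)/2.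

open import Defs
import Data.Nat.Properties as ℕP
open import Algebra.Properties.CommutativeMonoid.Sum ℕP.+-0-commutativeMonoid
  using (sum; ∑-distrib-+; sum-cong-≗; sum-replicate-zero)
open import Algebra.Properties.Semiring.Sum ℕP.+-*-semiring using (*-distribˡ-sum)
import Algebra.Properties.Group as GroupProperties
open import Data.Bool using (Bool; true; false; if_then_else_)
open import Data.Bool.Properties using (¬-not)
open import Data.Empty using (⊥; ⊥-elim)
open import Data.Fin as Fin using (Fin; toℕ; fromℕ<)
open import Data.Fin.Properties using (toℕ-fromℕ<)
open import Data.Fin.Subset using (Subset; _∈_; _∉_; _⊆_; ⁅_⁆; ∣_∣)
open import Data.Fin.Subset.Properties
  using (_∈?_; ⊆-antisym; p⊂q⇒∣p∣<∣q∣; p⊆q⇒∣p∣≤∣q∣; ∣⁅x⁆∣≡1; x∈⁅y⁆⇒x≡y; ∣p∣≤n)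
open import Data.Integer as ℤ using (+_)
import Data.Integer.Properties as ℤP
import Data.Integer.Tactic.RingSolver as ℤSolver
open import Data.List using (List; []; _∷_; _++_; length)
open import Data.List.Properties using (length-++; length-++-≤ʳ)
open import Data.Nat as ℕ using (ℕ; zero; suc; _∸_; _^_; _≤_; _<_; z≤n; s≤s; _≟_; _≤?_; _<?_)
import Data.Nat.Tactic.RingSolver as ℕSolver
open import Data.Product using (Σ; ∃₂; _×_; _,_; proj₂)
open import Data.Rational as ℚ using (ℚ; _⊔_; 0ℚ; 1ℚ; _/_; toℚᵘ) renaming (_≤_ to _≤ℚ_)
import Data.Rational.Properties as ℚP
open import Data.Rational.Unnormalised as ℚᵘ using (mkℚᵘ; *≡*)
import Data.Rational.Unnormalised.Properties as ℚᵘP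
open import Data.Vec using (lookup; tabulate)
open import Data.Vec.Properties using (lookup∘tabulate; []=⇒lookup; lookup⇒[]=)
open import Function using (_∘_)
open import Relation.Binary using (tri<; tri≈; tri>)
open import Relation.Binary.PropositionalEquality
open import Relation.Nullary using (yes; no; does)
open import Relation.Nullary.Decidable using (dec-true; dec-false)

-- Quarters

quarter : ℕ → ℚ
quarter a = + a / 4

/-cross : ∀ a b c d → a ℕ.* suc d ≡ c ℕ.* suc b → + a / suc b ≡ + c / suc d
/-cross a b c d eq = ℚP.fromℚᵘ-cong {mkℚᵘ (+ a) b} {mkℚᵘ (+ c) d}
  (*≡* (trans (sym (ℤP.pos-* a (suc d))) (trans (cong +_ eq) (ℤP.pos-* c (suc b)))))

quarter-4* : ∀ m → quarter (4 ℕ.* m) ≡ ℕ→ℚ m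
quarter-4* m = /-cross (4 ℕ.* m) 3 m 0 (trans (ℕP.*-identityʳ (4 ℕ.* m)) (ℕP.*-comm 4 m))

quarter-2* : ∀ m → quarter (2 ℕ.* m) ≡ + m / 2
quarter-2* m = /-cross (2 ℕ.* m) 3 m 1 (trans (ℕP.*-assoc 2 m 2) (trans (ℕP.*-comm 2 (m ℕ.* 2)) (ℕP.*-assoc m 2 2)))

quarter-+ : ∀ a b → quarter a ℚ.+ quarter b ≡ quarter (a ℕ.+ b)
quarter-+ a b = ℚP.toℚᵘ-injective (begin
  toℚᵘ (quarter a ℚ.+ quarter b)           ≈⟨ ℚP.toℚᵘ-homo-+ (quarter a) (quarter b) ⟩
  toℚᵘ (quarter a) ℚᵘ.+ toℚᵘ (quarter b)   ≈⟨ ℚᵘP.+-cong (toℚᵘ-quarter a) (toℚᵘ-quarter b) ⟩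
  mkℚᵘ (+ a) 3 ℚᵘ.+ mkℚᵘ (+ b) 3           ≈⟨ *≡* (cross (+ a) (+ b)) ⟩
  mkℚᵘ (+ (a ℕ.+ b)) 3                     ≈⟨ toℚᵘ-quarter (a ℕ.+ b) ⟨
  toℚᵘ (quarter (a ℕ.+ b))                 ∎)
  where
  open ℚᵘP.≃-Reasoning
  toℚᵘ-quarter : ∀ a → toℚᵘ (quarter a) ℚᵘ.≃ mkℚᵘ (+ a) 3
  toℚᵘ-quarter a = ℚP.toℚᵘ-fromℚᵘ (mkℚᵘ (+ a) 3)
  cross : ∀ x y → (x ℤ.* + 4 ℤ.+ y ℤ.* + 4) ℤ.* + 4 ≡ (x ℤ.+ y) ℤ.* + 16
  cross = ℤSolver.solve-∀

quarter-nonneg : ∀ a → 0ℚ ℚ.≤ quarter a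
quarter-nonneg a = ℚP.nonNegative⁻¹ (quarter a) {{ℚP.normalize-nonNeg a 4}}

quarter-≤-+ : ∀ a c → quarter a ℚ.≤ quarter (a ℕ.+ c)
quarter-≤-+ a c = begin
  quarter a              ≡⟨ ℚP.+-identityʳ (quarter a) ⟨
  quarter a ℚ.+ 0ℚ       ≤⟨ ℚP.+-monoʳ-≤ (quarter a) (quarter-nonneg c) ⟩
  quarter a ℚ.+ quarter c ≡⟨ quarter-+ a c ⟩
  quarter (a ℕ.+ c)      ∎
  where open ℚP.≤-Reasoning

quarter-<-+1 : ∀ a → quarter a ℚ.< quarter (a ℕ.+ 1)
quarter-<-+1 a = begin-strict
  quarter a               ≡⟨ ℚP.+-identityʳ (quarter a) ⟨
  quarter a ℚ.+ 0ℚ        <⟨ ℚP.+-monoʳ-< (quarter a) (ℚP.positive⁻¹ (quarter 1) {{ℚP.normalize-pos 1 4}}) ⟩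
  quarter a ℚ.+ quarter 1 ≡⟨ quarter-+ a 1 ⟩
  quarter (a ℕ.+ 1)       ∎
  where open ℚP.≤-Reasoning

quarter-mono-≤ : ∀ {a b} → a ≤ b → quarter a ℚ.≤ quarter b
quarter-mono-≤ {a} a≤b = subst (λ b → quarter a ℚ.≤ quarter b) (ℕP.m+[n∸m]≡n a≤b) (quarter-≤-+ a _)

quarter-mono-< : ∀ {a b} → a < b → quarter a ℚ.< quarter b
quarter-mono-< {a} {b} a<b = ℚP.<-≤-trans (quarter-<-+1 a) (quarter-mono-≤ (subst (_≤ b) (ℕP.+-comm 1 a) a<b))

quarter-∸4 : ∀ b → 0ℚ ⊔ (quarter b ℚ.- 1ℚ) ≡ quarter (b ∸ 4)
quarter-∸4 0 = refl
quarter-∸4 1 = refl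
quarter-∸4 2 = refl
quarter-∸4 3 = refl
quarter-∸4 b@(suc (suc (suc (suc c)))) = begin
  0ℚ ⊔ (quarter b ℚ.- 1ℚ)             ≡⟨ cong (λ x → 0ℚ ⊔ (x ℚ.- 1ℚ)) (trans (cong quarter (ℕP.+-comm 4 c)) (sym (quarter-+ c 4))) ⟩
  0ℚ ⊔ (quarter c ℚ.+ 1ℚ ℚ.- 1ℚ)     ≡⟨ cong (0ℚ ⊔_) (GroupProperties.//-rightDividesʳ ℚP.+-0-group 1ℚ (quarter c)) ⟩
  0ℚ ⊔ quarter c                      ≡⟨ ℚP.p≤q⇒p⊔q≡q (quarter-nonneg c) ⟩
  quarter c                           ∎
  where open ≡-Reasoning

𝟙 : Bool → ℕ
𝟙 b = if b then 1 else 0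

sumF-quarter : ∀ {n} (f : Fin n → ℕ) → sumF (quarter ∘ f) ≡ quarter (sum f)
sumF-quarter {zero}  f = refl
sumF-quarter {suc n} f =
  trans (cong (quarter (f Fin.zero) ℚ.+_) (sumF-quarter (f ∘ Fin.suc))) (quarter-+ (f Fin.zero) _)

∣tabulate∣≡sum : ∀ {n} (g : Fin n → Bool) → ∣ tabulate g ∣ ≡ sum (𝟙 ∘ g)
∣tabulate∣≡sum {zero}  g = refl
∣tabulate∣≡sum {suc n} g with g Fin.zero
... | true  = cong suc (∣tabulate∣≡sum (g ∘ Fin.suc))
... | false = ∣tabulate∣≡sum (g ∘ Fin.suc)

sum-𝟙-≟ : ∀ {n} j → j < n → sum (λ (k : Fin n) → 𝟙 (does (toℕ k ≟ j))) ≡ 1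
sum-𝟙-≟ {suc n} zero    _         = cong suc (sum-replicate-zero n)
sum-𝟙-≟ {suc n} (suc j) (s≤s j<n) = sum-𝟙-≟ j j<n

⊆-of-no-crossing : ∀ {n} {S T : Subset n} → ∣ T ∣ ≤ ∣ S ∣ →
  (∀ {k l} → k ∈ T → k ∉ S → l ∈ S → l ∉ T → ⊥) → T ⊆ S
⊆-of-no-crossing {S = S} {T} ∣T∣≤∣S∣ no-crossing {k} k∈T with k ∈? S
... | yes k∈S = k∈S
... | no  k∉S = ⊥-elim (ℕP.<⇒≱ (p⊂q⇒∣p∣<∣q∣ (S⊆T , k , k∈T , k∉S)) ∣T∣≤∣S∣)
  where
  S⊆T : S ⊆ T
  S⊆T {l} l∈S with l ∈? T
  ... | yes l∈T = l∈T
  ... | no  l∉T = ⊥-elim (no-crossing k∈T k∉S l∈S l∉T)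

greedy-forced : ∀ {n} {b : Fills n} {T S : Subset n} →
  (∀ {k l} → k ∈ T → l ∉ T → b l ℚ.< b k) → IsGreedy b ∣ T ∣ S → S ≡ T
greedy-forced {T = T} {S} gap (∣S∣≡∣T∣ , greedy) =
  ⊆-antisym (⊆-of-no-crossing (ℕP.≤-reflexive ∣S∣≡∣T∣) (λ l∈S l∉T k∈T k∉S → crossing k∈T k∉S l∈S l∉T))
            (⊆-of-no-crossing (ℕP.≤-reflexive (sym ∣S∣≡∣T∣)) crossing)
  where
  crossing : ∀ {k l} → k ∈ T → k ∉ S → l ∈ S → l ∉ T → ⊥
  crossing k∈T k∉S l∈S l∉T = ℚP.<-irrefl refl (ℚP.<-≤-trans (gap k∈T l∉T) (greedy _ _ l∈S k∉S))

-- Shifting a quarter between cups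

-- Cup heights in quarter units; cups are indexed by ℕ and those beyond n are never touched.
Heights : Set
Heights = ℕ → ℕ

-- (i , j) moves a quarter from cup j onto cup i; cup j is truncated at 0.
Shift : Set
Shift = ℕ × ℕ

shift : Heights → Shift → Heights
shift v (i , j) k = if does (k ≟ i) then suc (v k) else if does (k ≟ j) then v k ∸ 1 else v k

shift-cong : ∀ {v v′} o → v ≗ v′ → shift v o ≗ shift v′ o
shift-cong (i , j) v≗v′ k with does (k ≟ i) | does (k ≟ j)
... | true  | _     = cong suc (v≗v′ k)
... | false | true  = cong (_∸ 1) (v≗v′ k)
... | false | false = v≗v′ k

record Admissible (n : ℕ) (v : Heights) (i j : ℕ) : Set where
  field
    target<n        : i < n
    source<n        : j < n
    target≢source   : i ≢ j
    target≤source+1 : v i ≤ suc (v j)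

data Role (v : Heights) (i j k : ℕ) : Set where
  source : k ≡ j → k ≢ i → Role v i j k
  target : k ≡ i → k ≢ j → Role v i j k
  tall   : k ≢ i → k ≢ j → 3 ℕ.+ v j ≤ v k → Role v i j k
  short  : k ≢ i → k ≢ j → v k < 3 ℕ.+ v j → Role v i j k

role : ∀ {v i j} → i ≢ j → ∀ k → Role v i j k
role {v} {i} {j} i≢j k with k ≟ j | k ≟ i
... | yes k≡j | _       = source k≡j (λ k≡i → i≢j (trans (sym k≡i) k≡j))
... | no  k≢j | yes k≡i = target k≡i k≢j
... | no  k≢j | no  k≢i with 3 ℕ.+ v j ≤? v k
...   | yes tall≤ = tall k≢i k≢j tall≤
...   | no  ¬tall = short k≢i k≢j (ℕP.≰⇒> ¬tall)

module _ {v : Heights} {i j k : ℕ} where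

  drains : Role v i j k → Bool
  drains (source _ _)  = true
  drains (tall _ _ _)  = true
  drains (target _ _)  = false
  drains (short _ _ _) = false

  amount : Role v i j k → ℕ
  amount (source _ _)  = 3
  amount (tall _ _ _)  = 4
  amount (target _ _)  = 1
  amount (short _ _ _) = 0

  amount≤4 : (r : Role v i j k) → amount r ≤ 4
  amount≤4 (source _ _)  = ℕP.n≤1+n 3
  amount≤4 (tall _ _ _)  = ℕP.≤-refl
  amount≤4 (target _ _)  = s≤s z≤n
  amount≤4 (short _ _ _) = z≤n

  amount-balance : (r : Role v i j k) →
    amount r ℕ.+ 𝟙 (does (k ≟ j)) ≡ 4 ℕ.* 𝟙 (drains r) ℕ.+ 𝟙 (does (k ≟ i))
  amount-balance (source k≡j k≢i)
    rewrite dec-true (k ≟ j) k≡j | dec-false (k ≟ i) k≢i = refl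
  amount-balance (target k≡i k≢j)
    rewrite dec-true (k ≟ i) k≡i | dec-false (k ≟ j) k≢j = refl
  amount-balance (tall k≢i k≢j _)
    rewrite dec-false (k ≟ i) k≢i | dec-false (k ≟ j) k≢j = refl
  amount-balance (short k≢i k≢j _)
    rewrite dec-false (k ≟ i) k≢i | dec-false (k ≟ j) k≢j = refl

  drains-above : (r : Role v i j k) → drains r ≡ true → 3 ℕ.+ v j ≤ amount r ℕ.+ v k
  drains-above (source refl _)  _ = ℕP.≤-refl
  drains-above (tall _ _ 3+vj≤) _ = ℕP.≤-trans 3+vj≤ (ℕP.m≤n+m (v k) 4)

  stays-below : v i ≤ suc (v j) → (r : Role v i j k) → drains r ≡ false → amount r ℕ.+ v k < 3 ℕ.+ v j
  stays-below vi≤ (target refl _) _ = s≤s (s≤s vi≤)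
  stays-below _   (short _ _ vk<)  _ = vk<

  drain-shift : (r : Role v i j k) →
    (if drains r then (amount r ℕ.+ v k) ∸ 4 else amount r ℕ.+ v k) ≡ shift v (i , j) k
  drain-shift (source refl k≢i)
    rewrite dec-false (k ≟ i) k≢i | dec-true (k ≟ k) refl = refl
  drain-shift (target refl _)
    rewrite dec-true (k ≟ k) refl = refl
  drain-shift (tall k≢i k≢j _)
    rewrite dec-false (k ≟ i) k≢i | dec-false (k ≟ j) k≢j = refl
  drain-shift (short k≢i k≢j _)
    rewrite dec-false (k ≟ i) k≢i | dec-false (k ≟ j) k≢j = refl

  drains-source : k ≡ j → (r : Role v i j k) → drains r ≡ true
  drains-source _   (source _ _)      = refl
  drains-source _   (tall _ _ _)      = refl
  drains-source k≡j (target _ k≢j)    = ⊥-elim (k≢j k≡j)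
  drains-source k≡j (short _ k≢j _)   = ⊥-elim (k≢j k≡j)

-- Forcing a shift in one round

module ShiftRound {n : ℕ} {v : Heights} {i j : ℕ} (adm : Admissible n v i j) where
  open Admissible adm

  roleAt : ∀ k → Role v i j k
  roleAt = role target≢source

  drained : Subset n
  drained = tabulate (λ k → drains (roleAt (toℕ k)))

  lookup-drained : ∀ k → lookup drained k ≡ drains (roleAt (toℕ k))
  lookup-drained = lookup∘tabulate _

  drains-if-∈ : ∀ {k} → k ∈ drained → drains (roleAt (toℕ k)) ≡ true
  drains-if-∈ {k} k∈ = trans (sym (lookup-drained k)) ([]=⇒lookup k∈)

  stays-if-∉ : ∀ {k} → k ∉ drained → drains (roleAt (toℕ k)) ≡ false
  stays-if-∉ {k} k∉ = ¬-not (λ drains≡true → k∉ (lookup⇒[]= k drained (trans (lookup-drained k) drains≡true)))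

  1≤∣drained∣ : 1 ≤ ∣ drained ∣
  1≤∣drained∣ = subst (_≤ ∣ drained ∣) (∣⁅x⁆∣≡1 j′) (p⊆q⇒∣p∣≤∣q∣ ⁅j′⁆⊆drained)
    where
    j′ : Fin n
    j′ = fromℕ< source<n
    ⁅j′⁆⊆drained : ⁅ j′ ⁆ ⊆ drained
    ⁅j′⁆⊆drained {k} k∈⁅j′⁆ = lookup⇒[]= k drained (trans (lookup-drained k)
      (drains-source (trans (cong toℕ (x∈⁅y⁆⇒x≡y j′ k∈⁅j′⁆)) (toℕ-fromℕ< source<n)) (roleAt (toℕ k))))

  amountAt : Fin n → ℕ
  amountAt k = amount (roleAt (toℕ k))

  sum-amountAt : sum amountAt ≡ 4 ℕ.* ∣ drained ∣
  sum-amountAt = ℕP.+-cancelʳ-≡ 1 _ _ (begin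
    sum amountAt ℕ.+ 1
      ≡⟨ cong (sum amountAt ℕ.+_) (sum-𝟙-≟ j source<n) ⟨
    sum amountAt ℕ.+ sum (δ j)
      ≡⟨ ∑-distrib-+ amountAt (δ j) ⟨
    sum (λ k → amountAt k ℕ.+ δ j k)
      ≡⟨ sum-cong-≗ {n} {λ k → amountAt k ℕ.+ δ j k} {λ k → 4 ℕ.* d k ℕ.+ δ i k} (amount-balance ∘ roleAt ∘ toℕ) ⟩
    sum (λ k → 4 ℕ.* d k ℕ.+ δ i k)
      ≡⟨ ∑-distrib-+ (λ k → 4 ℕ.* d k) (δ i) ⟩
    sum (λ k → 4 ℕ.* d k) ℕ.+ sum (δ i)
      ≡⟨ cong₂ ℕ._+_ (*-distribˡ-sum {n} 4 d) (sym (sum-𝟙-≟ i target<n)) ⟨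
    4 ℕ.* sum d ℕ.+ 1
      ≡⟨ cong (λ c → 4 ℕ.* c ℕ.+ 1) (∣tabulate∣≡sum {n} (λ k → drains (roleAt (toℕ k)))) ⟨
    4 ℕ.* ∣ drained ∣ ℕ.+ 1
      ∎)
    where
    open ≡-Reasoning
    δ : ℕ → Fin n → ℕ
    δ x k = 𝟙 (does (toℕ k ≟ x))
    d : Fin n → ℕ
    d k = 𝟙 (drains (roleAt (toℕ k)))

  shiftMove : Move n
  shiftMove = record
    { p       = ∣ drained ∣
    ; p≥1     = 1≤∣drained∣
    ; p≤n     = ∣p∣≤n drained
    ; amt     = quarter ∘ amountAt
    ; amt≥0   = quarter-nonneg ∘ amountAt
    ; amt≤1   = λ k → quarter-mono-≤ (amount≤4 (roleAt (toℕ k)))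
    ; amt-sum = trans (sumF-quarter amountAt) (trans (cong quarter sum-amountAt) (quarter-4* ∣ drained ∣))
    }

  module _ {s : Fills n} (s≡ : ∀ k → s k ≡ quarter (v (toℕ k))) where

    filled : ∀ k → addMove s shiftMove k ≡ quarter (amountAt k ℕ.+ v (toℕ k))
    filled k = trans (cong (ℚ._+ quarter (amountAt k)) (s≡ k))
                     (trans (ℚP.+-comm (quarter (v (toℕ k))) _) (quarter-+ (amountAt k) _))

    drained-gap : ∀ {k l} → k ∈ drained → l ∉ drained → addMove s shiftMove l ℚ.< addMove s shiftMove k
    drained-gap {k} {l} k∈ l∉ = subst₂ ℚ._<_ (sym (filled l)) (sym (filled k)) (quarter-mono-<
      (ℕP.<-≤-trans (stays-below target≤source+1 (roleAt (toℕ l)) (stays-if-∉ l∉))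
                    (drains-above (roleAt (toℕ k)) (drains-if-∈ k∈))))

    greedy-realises-shift : ∀ {m} → m ≡ shiftMove → ∀ {S} → IsGreedy (addMove s m) (p m) S →
      ∀ k → emptySet (addMove s m) S k ≡ quarter (shift v (i , j) (toℕ k))
    greedy-realises-shift refl {S} greedy k = begin
      emptySet (addMove s shiftMove) S k
        ≡⟨ cong (λ T → emptySet (addMove s shiftMove) T k) (greedy-forced drained-gap greedy) ⟩
      (if lookup drained k then 0ℚ ⊔ (addMove s shiftMove k ℚ.- 1ℚ) else addMove s shiftMove k)
        ≡⟨ cong₂ (λ c x → if c then 0ℚ ⊔ (x ℚ.- 1ℚ) else x) (lookup-drained k) (filled k) ⟩
      (if drains r then 0ℚ ⊔ (quarter f ℚ.- 1ℚ) else quarter f)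
        ≡⟨ empty-quarter (drains r) ⟩
      quarter (if drains r then f ∸ 4 else f)
        ≡⟨ cong quarter (drain-shift r) ⟩
      quarter (shift v (i , j) (toℕ k)) ∎
      where
      open ≡-Reasoning
      r : Role v i j (toℕ k)
      r = roleAt (toℕ k)
      f : ℕ
      f = amountAt k ℕ.+ v (toℕ k)
      empty-quarter : ∀ c → (if c then 0ℚ ⊔ (quarter f ℚ.- 1ℚ) else quarter f) ≡ quarter (if c then f ∸ 4 else f)
      empty-quarter true  = quarter-∸4 f
      empty-quarter false = refl

open ShiftRound using (shiftMove; greedy-realises-shift)

-- Runs of admissible shifts and the strategy following one

data Run (n : ℕ) : Heights → List Shift → Heights → Set where
  done : ∀ {v w} → v ≗ w → Run n v [] w
  _∷_  : ∀ {v i j os w} → Admissible n v i j → Run n (shift v (i , j)) os w → Run n v ((i , j) ∷ os) w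

module _ {n : ℕ} where

  Admissible-cong : ∀ {v v′ i j} → v ≗ v′ → Admissible n v i j → Admissible n v′ i j
  Admissible-cong {i = i} {j} v≗v′ adm = record
    { target<n        = target<n
    ; source<n        = source<n
    ; target≢source   = target≢source
    ; target≤source+1 = subst₂ (λ x y → x ≤ suc y) (v≗v′ i) (v≗v′ j) target≤source+1
    }
    where open Admissible adm

  Run-congˡ : ∀ {v v′ os w} → v ≗ v′ → Run n v′ os w → Run n v os w
  Run-congˡ v≗v′ (done v′≗w)   = done (λ k → trans (v≗v′ k) (v′≗w k))
  Run-congˡ v≗v′ (adm ∷ run)   =
    Admissible-cong (λ k → sym (v≗v′ k)) adm ∷ Run-congˡ (shift-cong _ v≗v′) run

  Run-congʳ : ∀ {v os w w′} → Run n v os w → w ≗ w′ → Run n v os w′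
  Run-congʳ (done v≗w)  w≗w′ = done (λ k → trans (v≗w k) (w≗w′ k))
  Run-congʳ (adm ∷ run) w≗w′ = adm ∷ Run-congʳ run w≗w′

  Run-++ : ∀ {u xs v ys w} → Run n u xs v → Run n v ys w → Run n u (xs ++ ys) w
  Run-++ (done u≗v)  run′ = Run-congˡ u≗v run′
  Run-++ (adm ∷ run) run′ = adm ∷ Run-++ run run′

  heightsAt : ∀ {v os w} → Run n v os w → ℕ → Heights
  heightsAt {v = v} _           zero    = v
  heightsAt {v = v} (done _)    (suc t) = v
  heightsAt         (_ ∷ run)   (suc t) = heightsAt run t

  heightsAt-end : ∀ {v os w} (run : Run n v os w) → heightsAt run (length os) ≗ w
  heightsAt-end (done v≗w) = v≗w
  heightsAt-end (_ ∷ run)  = heightsAt-end run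

  module _ (fallback : Move n) where

    moveAt : ∀ {v os w} → Run n v os w → ℕ → Move n
    moveAt (done _)    _       = fallback
    moveAt (adm ∷ _)   zero    = shiftMove adm
    moveAt (_ ∷ run)   (suc t) = moveAt run t

    moveAt-admissible : ∀ {v os w} (run : Run n v os w) {t} → t < length os →
      ∃₂ λ i j → Σ (Admissible n (heightsAt run t) i j) λ adm →
        moveAt run t ≡ shiftMove adm × heightsAt run (suc t) ≡ shift (heightsAt run t) (i , j)
    moveAt-admissible (adm ∷ _)   {zero}  _         = _ , _ , adm , refl , refl
    moveAt-admissible (_ ∷ run)   {suc t} (s≤s t<l) = moveAt-admissible run t<l

    follow : ∀ {v os w} → Run n v os w → FillerStrategy n
    follow run h = moveAt run (length h)

    follow-invariant : ∀ {os w} (run : Run n (λ _ → 0) os w) (E : GreedyEmptier n) {t} → t ≤ length os →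
      ∀ k → stateOf (play (follow run) E t) k ≡ quarter (heightsAt run t (toℕ k))
    follow-invariant run E {zero}  _   k = refl
    follow-invariant run E {suc t} t<l k with moveAt-admissible run t<l
    ... | i , j , adm , move≡ , next≡ = trans
      (greedy-realises-shift adm (follow-invariant run E (ℕP.<⇒≤ t<l))
         (trans (cong (moveAt run) (length-play t)) move≡) (proj₂ (E h (follow run h))) k)
      (cong (λ v → quarter (v (toℕ k))) (sym next≡))
      where
      h : History n
      h = play (follow run) E t
      length-play : ∀ t → length (play (follow run) E t) ≡ t
      length-play zero    = refl
      length-play (suc t) = cong suc (length-play t)

    follow-reaches : ∀ {os w} (run : Run n (λ _ → 0) os w) (E : GreedyEmptier n) →
      ∀ k → stateOf (play (follow run) E (length os)) k ≡ quarter (w (toℕ k))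
    follow-reaches run E k =
      trans (follow-invariant run E ℕP.≤-refl k) (cong quarter (heightsAt-end run (toℕ k)))

-- The staircase schedule

raise : ℕ → Heights → Heights
raise a v k = if does (k ≟ a) then suc (v k) else v k

raiseBelow : ℕ → Heights → Heights
raiseBelow a v k = if does (k <? a) then suc (v k) else v k

Steep : Heights → ℕ → ℕ → Set
Steep v a b = ∀ x → a ≤ x → x < b → v x ≡ 2 ℕ.+ v (suc x)

stairs : ℕ → Heights
stairs k x = 2 ℕ.* (k ∸ x)

cascade : ℕ → ℕ → List Shift
cascade a zero    = []
cascade a (suc d) = (d ℕ.+ a , suc d ℕ.+ a) ∷ cascade a d

feed : ℕ → ℕ → ℕ → List Shift
feed z a d = (d ℕ.+ a , z) ∷ cascade a d

sweep : ℕ → ℕ → ℕ → ℕ → List Shift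
sweep z k a zero    = []
sweep z k a (suc r) = feed z a (k ∸ a) ++ sweep z k (suc a) r

phase : ℕ → ℕ → List Shift
phase z k = sweep z k 0 (suc k) ++ sweep z k 0 (suc k)

schedule : ℕ → ℕ → List Shift
schedule z zero    = []
schedule z (suc k) = schedule z k ++ phase z k

module _ {v : Heights} where

  raise-at : ∀ a → raise a v a ≡ suc (v a)
  raise-at a rewrite dec-true (a ≟ a) refl = refl

  raise-elsewhere : ∀ {a k} → k ≢ a → raise a v k ≡ v k
  raise-elsewhere {a} {k} k≢a rewrite dec-false (k ≟ a) k≢a = refl

  raiseBelow-< : ∀ {a k} → k < a → raiseBelow a v k ≡ suc (v k)
  raiseBelow-< {a} {k} k<a rewrite dec-true (k <? a) k<a = refl

  raiseBelow-≥ : ∀ {a k} → a ≤ k → raiseBelow a v k ≡ v k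
  raiseBelow-≥ {a} {k} a≤k rewrite dec-false (k <? a) (ℕP.≤⇒≯ a≤k) = refl

  shift-raise : ∀ {i j} → i ≢ j → shift (raise j v) (i , j) ≗ raise i v
  shift-raise {i} {j} i≢j k with k ≟ i | k ≟ j
  ... | yes refl | yes refl = ⊥-elim (i≢j refl)
  ... | yes refl | no  k≢j  rewrite dec-true (k ≟ k) refl | dec-false (k ≟ j) k≢j = refl
  ... | no  k≢i  | yes refl rewrite dec-false (k ≟ i) k≢i | dec-true (k ≟ k) refl = refl
  ... | no  k≢i  | no  k≢j  rewrite dec-false (k ≟ i) k≢i | dec-false (k ≟ j) k≢j = refl

  shift-from-empty : ∀ {i j} → i ≢ j → v j ≡ 0 → shift v (i , j) ≗ raise i v
  shift-from-empty {i} {j} i≢j vj≡0 k with k ≟ i | k ≟ j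
  ... | yes refl | yes refl = ⊥-elim (i≢j refl)
  ... | yes refl | no  k≢j  rewrite dec-true (k ≟ k) refl = refl
  ... | no  k≢i  | yes refl rewrite dec-false (k ≟ i) k≢i | dec-true (k ≟ k) refl | vj≡0 = refl
  ... | no  k≢i  | no  k≢j  rewrite dec-false (k ≟ i) k≢i | dec-false (k ≟ j) k≢j = refl

  Steep-raiseBelow-above : ∀ {a b c} → a ≤ c → Steep v c b → Steep (raiseBelow a v) c b
  Steep-raiseBelow-above a≤c steep x c≤x x<b =
    trans (raiseBelow-≥ (ℕP.≤-trans a≤c c≤x))
      (trans (steep x c≤x x<b) (cong (2 ℕ.+_) (sym (raiseBelow-≥ (ℕP.≤-trans a≤c (ℕP.m≤n⇒m≤1+n c≤x))))))

  Steep-raiseBelow-below : ∀ {a b c} → b < a → Steep v c b → Steep (raiseBelow a v) c b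
  Steep-raiseBelow-below b<a steep x c≤x x<b =
    trans (raiseBelow-< (ℕP.<-trans x<b b<a))
      (trans (cong suc (steep x c≤x x<b)) (cong (2 ℕ.+_) (sym (raiseBelow-< (ℕP.≤-<-trans x<b b<a)))))

raise-raiseBelow : ∀ {v} a → raise a (raiseBelow a v) ≗ raiseBelow (suc a) v
raise-raiseBelow {v} a k with ℕP.<-cmp k a
... | tri< k<a _ _  = trans (raise-elsewhere {raiseBelow a v} (ℕP.<⇒≢ k<a))
                        (trans (raiseBelow-< {v} k<a) (sym (raiseBelow-< {v} (ℕP.m<n⇒m<1+n k<a))))
... | tri≈ _ refl _ = trans (raise-at {raiseBelow a v} k)
                        (trans (cong suc (raiseBelow-≥ {v} ℕP.≤-refl)) (sym (raiseBelow-< {v} ℕP.≤-refl)))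
... | tri> _ _ a<k  = trans (raise-elsewhere {raiseBelow a v} (ℕP.<⇒≢ a<k ∘ sym))
                        (trans (raiseBelow-≥ {v} (ℕP.<⇒≤ a<k)) (sym (raiseBelow-≥ {v} a<k)))

stairs-flat : ∀ {k x} → k ≤ x → stairs k x ≡ 0
stairs-flat k≤x = cong (2 ℕ.*_) (ℕP.m≤n⇒m∸n≡0 k≤x)

stairs-steep : ∀ k → Steep (stairs k) 0 k
stairs-steep k x _ x<k =
  trans (cong (2 ℕ.*_) (ℕP.+-∸-assoc 1 x<k)) (ℕP.*-suc 2 (k ∸ suc x))

raiseBelow²-stairs : ∀ k → raiseBelow (suc k) (raiseBelow (suc k) (stairs k)) ≗ stairs (suc k)
raiseBelow²-stairs k x with x ≤? k
... | yes x≤k = begin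
  raiseBelow (suc k) (raiseBelow (suc k) (stairs k)) x ≡⟨ raiseBelow-< {raiseBelow (suc k) (stairs k)} (s≤s x≤k) ⟩
  suc (raiseBelow (suc k) (stairs k) x)                ≡⟨ cong suc (raiseBelow-< {stairs k} (s≤s x≤k)) ⟩
  2 ℕ.+ stairs k x                                     ≡⟨ ℕP.*-suc 2 (k ∸ x) ⟨
  2 ℕ.* suc (k ∸ x)                                    ≡⟨ cong (2 ℕ.*_) (ℕP.+-∸-assoc 1 x≤k) ⟨
  stairs (suc k) x                                     ∎
  where open ≡-Reasoning
... | no  x≰k = begin
  raiseBelow (suc k) (raiseBelow (suc k) (stairs k)) x ≡⟨ raiseBelow-≥ {raiseBelow (suc k) (stairs k)} k<x ⟩
  raiseBelow (suc k) (stairs k) x                      ≡⟨ raiseBelow-≥ {stairs k} k<x ⟩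
  stairs k x                                           ≡⟨ stairs-flat (ℕP.<⇒≤ k<x) ⟩
  0                                                    ≡⟨ stairs-flat k<x ⟨
  stairs (suc k) x                                     ∎
  where
  open ≡-Reasoning
  k<x : k < x
  k<x = ℕP.≰⇒> x≰k

module _ {n : ℕ} where

  cascade-run : ∀ {v} a d → Steep v a (d ℕ.+ a) → d ℕ.+ a < n → Run n (raise (d ℕ.+ a) v) (cascade a d) (raise a v)
  cascade-run a zero    _     _     = done (λ _ → refl)
  cascade-run {v} a (suc d) steep top<n = admissible ∷ Run-congˡ (shift-raise {v} i≢j) (cascade-run a d steep′ i<n)
    where
    i : ℕ
    i = d ℕ.+ a
    i<n : i < n
    i<n = ℕP.<-trans (ℕP.n<1+n i) top<n
    i≢j : i ≢ suc i
    i≢j = ℕP.<⇒≢ (ℕP.n<1+n i)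
    steep′ : Steep v a i
    steep′ x a≤x x<i = steep x a≤x (ℕP.m<n⇒m<1+n x<i)
    admissible : Admissible n (raise (suc i) v) i (suc i)
    admissible = record
      { target<n        = i<n
      ; source<n        = top<n
      ; target≢source   = i≢j
      ; target≤source+1 = ℕP.≤-reflexive (trans (raise-elsewhere {v} i≢j)
          (trans (steep i (ℕP.m≤n+m a d) (ℕP.n<1+n i)) (cong suc (sym (raise-at {v} (suc i))))))
      }

  feed-run : ∀ {v z} a d → v z ≡ 0 → d ℕ.+ a < z → z < n → v (d ℕ.+ a) ≤ 1 → Steep v a (d ℕ.+ a) →
    Run n v (feed z a d) (raise a v)
  feed-run {v} {z} a d vz≡0 top<z z<n vtop≤1 steep =
    admissible ∷ Run-congˡ (shift-from-empty {v} (ℕP.<⇒≢ top<z) vz≡0) (cascade-run a d steep (ℕP.<-trans top<z z<n))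
    where
    admissible : Admissible n v (d ℕ.+ a) z
    admissible = record
      { target<n        = ℕP.<-trans top<z z<n
      ; source<n        = z<n
      ; target≢source   = ℕP.<⇒≢ top<z
      ; target≤source+1 = subst (λ c → v (d ℕ.+ a) ≤ suc c) (sym vz≡0) vtop≤1
      }

  module _ {z k : ℕ} {v : Heights} (k<z : k < z) (z<n : z < n) (vz≡0 : v z ≡ 0) (vk≤1 : v k ≤ 1)
           (steep : Steep v 0 k) where

    sweep-run : ∀ r a → r ℕ.+ a ≡ suc k → Run n (raiseBelow a v) (sweep z k a r) (raiseBelow (suc k) v)
    sweep-run zero    a a≡1+k   = done (λ x → cong (λ c → raiseBelow c v x) a≡1+k)
    sweep-run (suc r) a r+a≡k′ = Run-++
      (Run-congʳ (feed-run a (k ∸ a) vz≡0′ (subst (_< z) (sym top≡k) k<z) z<n vtop≤1 steep′) (raise-raiseBelow {v} a))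
      (sweep-run r (suc a) (trans (ℕP.+-suc r a) r+a≡k′))
      where
      a≤k : a ≤ k
      a≤k = subst (a ≤_) (ℕP.suc-injective r+a≡k′) (ℕP.m≤n+m a r)
      top≡k : k ∸ a ℕ.+ a ≡ k
      top≡k = ℕP.m∸n+n≡m a≤k
      vz≡0′ : raiseBelow a v z ≡ 0
      vz≡0′ = trans (raiseBelow-≥ {v} (ℕP.≤-trans a≤k (ℕP.<⇒≤ k<z))) vz≡0
      vtop≤1 : raiseBelow a v (k ∸ a ℕ.+ a) ≤ 1
      vtop≤1 = subst (λ c → raiseBelow a v c ≤ 1) (sym top≡k) (subst (_≤ 1) (sym (raiseBelow-≥ {v} a≤k)) vk≤1)
      steep′ : Steep (raiseBelow a v) a (k ∸ a ℕ.+ a)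
      steep′ = Steep-raiseBelow-above {v} ℕP.≤-refl (λ x _ x<top → steep x z≤n (subst (x <_) top≡k x<top))

  phase-run : ∀ {z k} → k < z → z < n → Run n (stairs k) (phase z k) (stairs (suc k))
  phase-run {z} {k} k<z z<n = Run-++
    (sweep-run k<z z<n (stairs-flat (ℕP.<⇒≤ k<z)) (subst (_≤ 1) (sym stairs-k) z≤n) (stairs-steep k)
       (suc k) 0 (ℕP.+-identityʳ (suc k)))
    (Run-congʳ (sweep-run k<z z<n v₁z≡0 v₁k≤1 v₁-steep (suc k) 0 (ℕP.+-identityʳ (suc k)))
               (raiseBelow²-stairs k))
    where
    stairs-k : stairs k k ≡ 0
    stairs-k = stairs-flat {k} ℕP.≤-refl
    v₁z≡0 : raiseBelow (suc k) (stairs k) z ≡ 0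
    v₁z≡0 = trans (raiseBelow-≥ {stairs k} k<z) (stairs-flat (ℕP.<⇒≤ k<z))
    v₁k≤1 : raiseBelow (suc k) (stairs k) k ≤ 1
    v₁k≤1 = ℕP.≤-reflexive (trans (raiseBelow-< {stairs k} {k = k} ℕP.≤-refl) (cong suc stairs-k))
    v₁-steep : Steep (raiseBelow (suc k) (stairs k)) 0 k
    v₁-steep = Steep-raiseBelow-below {stairs k} (ℕP.n<1+n k) (stairs-steep k)

  schedule-run : ∀ {z} k → k ≤ z → z < n → Run n (λ _ → 0) (schedule z k) (stairs k)
  schedule-run zero    _   _   = done (λ x → sym (stairs-flat {x = x} z≤n))
  schedule-run (suc k) k<z z<n = Run-++ (schedule-run k (ℕP.<⇒≤ k<z) z<n) (phase-run k<z z<n)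

length-cascade : ∀ a d → length (cascade a d) ≡ d
length-cascade a zero    = refl
length-cascade a (suc d) = cong suc (length-cascade a d)

length-sweep : ∀ z k a r → length (sweep z k a r) ≤ r ℕ.* suc k
length-sweep z k a zero    = z≤n
length-sweep z k a (suc r) = begin
  length (feed z a (k ∸ a) ++ sweep z k (suc a) r)              ≡⟨ length-++ (feed z a (k ∸ a)) ⟩
  suc (length (cascade a (k ∸ a))) ℕ.+ length (sweep z k (suc a) r)
    ≤⟨ ℕP.+-mono-≤ (s≤s (ℕP.≤-trans (ℕP.≤-reflexive (length-cascade a (k ∸ a))) (ℕP.m∸n≤m k a)))
                   (length-sweep z k (suc a) r) ⟩
  suc k ℕ.+ r ℕ.* suc k                                          ∎
  where open ℕP.≤-Reasoning

length-phase : ∀ z k → length (phase z k) ≤ 2 ℕ.* (suc k ℕ.* suc k)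
length-phase z k = begin
  length (sweep z k 0 (suc k) ++ sweep z k 0 (suc k))           ≡⟨ length-++ (sweep z k 0 (suc k)) ⟩
  length (sweep z k 0 (suc k)) ℕ.+ length (sweep z k 0 (suc k))
    ≤⟨ ℕP.+-mono-≤ (length-sweep z k 0 (suc k))
                   (ℕP.≤-trans (length-sweep z k 0 (suc k)) (ℕP.m≤m+n _ 0)) ⟩
  2 ℕ.* (suc k ℕ.* suc k)                                        ∎
  where open ℕP.≤-Reasoning

cube-step : ∀ k → suc k ^ 3 ℕ.+ 2 ℕ.* (suc k ℕ.* suc k) ≤ suc (suc k) ^ 3
cube-step k = subst (suc k ^ 3 ℕ.+ 2 ℕ.* (suc k ℕ.* suc k) ≤_) (sym (expand k)) (ℕP.m≤m+n _ _)
  where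
  -- The powers are unfolded so that the solver sees a polynomial identity.
  expand : ∀ k → (2 ℕ.+ k) ℕ.* ((2 ℕ.+ k) ℕ.* ((2 ℕ.+ k) ℕ.* 1))
    ≡ (1 ℕ.+ k) ℕ.* ((1 ℕ.+ k) ℕ.* ((1 ℕ.+ k) ℕ.* 1)) ℕ.+ 2 ℕ.* ((1 ℕ.+ k) ℕ.* (1 ℕ.+ k))
      ℕ.+ ((1 ℕ.+ k) ℕ.* (1 ℕ.+ k) ℕ.+ 3 ℕ.* (1 ℕ.+ k) ℕ.+ 1)
  expand = ℕSolver.solve-∀

length-schedule : ∀ z k → length (schedule z k) < suc k ^ 3
length-schedule z zero    = s≤s z≤n
length-schedule z (suc k) = begin-strict
  length (schedule z k ++ phase z k)                ≡⟨ length-++ (schedule z k) ⟩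
  length (schedule z k) ℕ.+ length (phase z k)      <⟨ ℕP.+-mono-<-≤ (length-schedule z k) (length-phase z k) ⟩
  suc k ^ 3 ℕ.+ 2 ℕ.* (suc k ℕ.* suc k)             ≤⟨ cube-step k ⟩
  suc (suc k) ^ 3                                   ∎
  where open ℕP.≤-Reasoning

schedule-nonempty : ∀ z k → 1 ≤ length (schedule z (suc k))
schedule-nonempty z k = ℕP.<-≤-trans (s≤s z≤n) (length-++-≤ʳ (phase z k) {schedule z k})

unitMove : ∀ {n} → Move (suc n)
unitMove {n} = record
  { p       = 1
  ; p≥1     = ℕP.≤-refl
  ; p≤n     = s≤s z≤n
  ; amt     = firstCup
  ; amt≥0   = λ { Fin.zero → ℚP.nonNegative⁻¹ 1ℚ ; (Fin.suc _) → ℚP.≤-refl }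
  ; amt≤1   = λ { Fin.zero → ℚP.≤-refl ; (Fin.suc _) → ℚP.nonNegative⁻¹ 1ℚ }
  ; amt-sum = cong (1ℚ ℚ.+_) (sumF-zero n)
  }
  where
  firstCup : Fin (suc n) → ℚ
  firstCup Fin.zero    = 1ℚ
  firstCup (Fin.suc _) = 0ℚ
  sumF-zero : ∀ n → sumF {n} (λ _ → 0ℚ) ≡ 0ℚ
  sumF-zero zero    = refl
  sumF-zero (suc n) = cong (0ℚ ℚ.+_) (sumF-zero n)

theorem5p2 : (n : ℕ) → 1 ≤ n →
    Σ (FillerStrategy n) λ F → (E : GreedyEmptier n) →
    Σ ℕ λ t → 1 ≤ t × t ≤ n ^ 3 ×
    (+ (n ∸ 1) / 2) ≤ℚ backlog (stateOf (play F E t))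
theorem5p2 (suc zero)    _ = (λ _ → unitMove) , λ E →
  1 , ℕP.≤-refl , ℕP.≤-refl , ℚP.p≤q⊔p (stateOf (play (λ _ → unitMove) E 1) Fin.zero) 0ℚ
theorem5p2 (suc (suc m)) _ = follow unitMove run , λ E →
  length (schedule z z) , schedule-nonempty z m , ℕP.<⇒≤ (length-schedule z z) ,
  ℚP.≤-trans (ℚP.≤-reflexive (sym (trans (follow-reaches unitMove run E Fin.zero) (quarter-2* z))))
             (ℚP.p≤p⊔q _ _)
  where
  z : ℕ
  z = suc m
  run : Run (suc z) (λ _ → 0) (schedule z z) (stairs z)
  run = schedule-run z ℕP.≤-refl ℕP.≤-refl
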